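{- (1) $\mathbf{K_N^{Horn,\Box}}$ and $\mathbf{K_N^{Horn,\Diamond}}$ are $\prec$-incomparable (neither is at least as expressive as the other in the strong sense); (2) $\mathbf{K_N^{Krom,\Box}}$ and $\mathbf{K_N^{Krom,\Diamond}}$ are $\prec^w$-incomparable (neither is weakly at least as expressive as the other); (3) $\mathbf{K_N^{core,\Box}}$ and $\mathbf{K_N^{core,\Diamond}}$ are $\prec$-incomparable.
   Context: Fix a finite set $\tau$ of modality labels and a countable set $\mathcal P$ of propositional letters. Formulas of $\mathbf{K_N}$ are generated by $\varphi ::= \top \mid p \mid \neg\varphi \mid \varphi\vee\varphi \mid \Diamond_\alpha\varphi \mid \Box_\alpha\varphi$; $\wedge,\rightarrow$ are abbreviations, $\bot=\neg\top$. Models $M=(\mathcal F,V)$ with frame $\mathcal F=(W,\{R_\alpha\}_{\alpha\in\tau})$, $W\neq\emptyset$, $R_\alpha\subseteq W\times W$, $V:W\to2^{\mathcal P}$, standard Kripke semantics. Positive literals: $\lambda ::= \top \mid p \mid \Diamond_\alpha\lambda \mid \Box_\alpha\lambda$. Clausal form: $\varphi ::= \lambda \mid \neg\lambda \mid \nabla(\neg\lambda_1\vee\dots\vee\neg\lambda_n\vee\lambda_{n+1}\vee\dots\vee\lambda_{n+m}) \mid \varphi\wedge\varphi$, with positive literals $\lambda,\lambda_i$ and $\nabla$ a finite (possibly empty) sequence of boxes. $\mathbf{K_N^{Horn}}$: every clause has $m\le1$; $\mathbf{K_N^{Krom}}$: $n+m\le2$; $\mathbf{K_N^{core}}$: both.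 For $X\in\{\mathrm{Horn},\mathrm{Krom},\mathrm{core}\}$, $\mathbf{K_N^{X,\Box}}$ (resp. $\mathbf{K_N^{X,\Diamond}}$) is the subfragment of $\mathbf{K_N^{X}}$ whose positive literals contain no diamonds (resp. no boxes); prefixes $\nabla$ are unchanged. Expressivity (over all Kripke frames). Weak: $\mathbf L\preceq^w\mathbf L'$ if for a fixed alphabet $\mathcal P$ there is an effective translation $\varphi\mapsto\varphi'$ from $\mathbf L$-formulas to $\mathbf L'$-formulas over the same $\mathcal P$ with $M,w\Vdash\varphi$ iff $M,w\Vdash\varphi'$ for all $M,w$. Strong: for a model $M=(\mathcal F,V)$ over $\mathcal P$ and $\mathcal P'\supseteq\mathcal P$, an extension of $M$ is a model $(\mathcal F,V')$ over $\mathcal P'$ agreeing with $V$ on $\mathcal P$; $\mathbf L\preceq\mathbf L'$ if there is an effective translation taking each $\mathbf L$-formula $\varphi$ over $\mathcal P$ to an $\mathbf L'$-formula $\varphi'$ over some $\mathcal P'\supseteq\mathcal P$ (finitely many new letters) such that for all $M$ over $\mathcal P$ and $w$: $M,w\Vdash\varphi$ iff some extension $M'$ of $M$ has $M',w\Vdash\varphi'$. Two logics are $\prec$-incomparable (resp. $\prec^w$-incomparable) if neither $\preceq$ (resp. $\preceq^w$) the other. -}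

module Defs where

open import Data.Nat using (ℕ; _+_; _≤_)
open import Data.Fin using (Fin)
open import Data.List using (List; []; _∷_; length; map; foldr)
open import Data.List.Relation.Unary.All using (All)
open import Data.Product using (Σ; _×_; _,_)
open import Data.Sum using (_⊎_; [_,_])
open import Data.Unit using (⊤)
open import Data.Empty using (⊥)
open import Relation.Nullary using (¬_)
open import Function.Bundles using (_⇔_)

data Fm (τ A : Set) : Set where
  ⊤ᶠ   : Fm τ A
  var  : A → Fm τ A
  ¬ᶠ_  : Fm τ A → Fm τ A
  _∨ᶠ_ : Fm τ A → Fm τ A → Fm τ A
  ◇ᶠ   : τ → Fm τ A → Fm τ A
  □ᶠ   : τ → Fm τ A → Fm τ A

⊥ᶠ : {τ A : Set} → Fm τ A
⊥ᶠ = ¬ᶠ ⊤ᶠ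

_∧ᶠ_ : {τ A : Set} → Fm τ A → Fm τ A → Fm τ A
φ ∧ᶠ ψ = ¬ᶠ ((¬ᶠ φ) ∨ᶠ (¬ᶠ ψ))

record Frame (τ : Set) : Set₁ where
  field
    W : Set
    R : τ → W → W → Set
open Frame public

-- A model is a frame F together with a valuation V : W → (A → Set),
-- V w p meaning p ∈ V(w).
Sat : {τ A : Set} (F : Frame τ) → (W F → A → Set) → W F → Fm τ A → Set
Sat F V w ⊤ᶠ       = ⊤
Sat F V w (var p)  = V w p
Sat F V w (¬ᶠ φ)   = ¬ Sat F V w φ
Sat F V w (φ ∨ᶠ ψ) = Sat F V w φ ⊎ Sat F V w ψ
Sat F V w (◇ᶠ a φ) = Σ (W F) λ v → R F a w v × Sat F V v φ
Sat F V w (□ᶠ a φ) = (v : W F) → R F a w v → Sat F V v φ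

data Lit (τ A : Set) : Set where
  ⊤ˡ  : Lit τ A
  varˡ : A → Lit τ A
  ◇ˡ  : τ → Lit τ A → Lit τ A
  □ˡ  : τ → Lit τ A → Lit τ A

-- clausal formulas: λ | ¬λ | ∇(¬λ₁ ∨ … ∨ ¬λₙ ∨ λₙ₊₁ ∨ … ∨ λₙ₊ₘ) | φ ∧ φ
-- (∇ is the list of box labels; negs = [λ₁..λₙ], poss = [λₙ₊₁..λₙ₊ₘ])
data CF (τ A : Set) : Set where
  lit    : Lit τ A → CF τ A
  neglit : Lit τ A → CF τ A
  clause : (∇ : List τ) (negs poss : List (Lit τ A)) → CF τ A
  _∧ᶜ_   : CF τ A → CF τ A → CF τ A

litFm : {τ A : Set} → Lit τ A → Fm τ A
litFm ⊤ˡ       = ⊤ᶠ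
litFm (varˡ p) = var p
litFm (◇ˡ a l) = ◇ᶠ a (litFm l)
litFm (□ˡ a l) = □ᶠ a (litFm l)

disj : {τ A : Set} → List (Fm τ A) → Fm τ A
disj []           = ⊥ᶠ
disj (φ ∷ [])     = φ
disj (φ ∷ ψ ∷ φs) = φ ∨ᶠ disj (ψ ∷ φs)

boxes : {τ A : Set} → List τ → Fm τ A → Fm τ A
boxes ∇ φ = foldr □ᶠ φ ∇

cfFm : {τ A : Set} → CF τ A → Fm τ A
cfFm (lit l)              = litFm l
cfFm (neglit l)           = ¬ᶠ litFm l
cfFm (clause ∇ negs poss) =
  boxes ∇ (disj (foldr (λ l r → (¬ᶠ litFm l) ∷ r) (map litFm poss) negs))
cfFm (φ ∧ᶜ ψ)             = cfFm φ ∧ᶠ cfFm ψ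

data Shape : Set where
  Horn Krom Core : Shape

data Pol : Set where
  BoxOnly DiaOnly : Pol

-- n = number of negative literals, m = number of positive literals
ShapeOK : Shape → ℕ → ℕ → Set
ShapeOK Horn n m = m ≤ 1
ShapeOK Krom n m = n + m ≤ 2
ShapeOK Core n m = (m ≤ 1) × (n + m ≤ 2)

LitOK : {τ A : Set} → Pol → Lit τ A → Set
LitOK p       ⊤ˡ       = ⊤
LitOK p       (varˡ _) = ⊤
LitOK BoxOnly (◇ˡ _ _) = ⊥
LitOK BoxOnly (□ˡ _ l) = LitOK BoxOnly l
LitOK DiaOnly (◇ˡ _ l) = LitOK DiaOnly l
LitOK DiaOnly (□ˡ _ _) = ⊥

InFrag : {τ A : Set} → Shape → Pol → CF τ A → Set
InFrag s p (lit l)              = LitOK p l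
InFrag s p (neglit l)           = LitOK p l
InFrag s p (clause ∇ negs poss) =
  All (LitOK p) negs × All (LitOK p) poss × ShapeOK s (length negs) (length poss)
InFrag s p (φ ∧ᶜ ψ)             = InFrag s p φ × InFrag s p ψ

record Logic : Set where
  constructor logic
  field
    shape : Shape
    pol   : Pol

Form : Set → Set → Logic → Set
Form τ A (logic s p) = Σ (CF τ A) (InFrag s p)

toFm : {τ A : Set} {L : Logic} → Form τ A L → Fm τ A
toFm (φ , _) = cfFm φ

_⪯ʷ[_]_ : Logic → Set → Logic → Set₁
L ⪯ʷ[ τ ] L' =
  Σ (Form τ ℕ L → Form τ ℕ L') λ T →
    (φ : Form τ ℕ L) (F : Frame τ) (V : W F → ℕ → Set) (w : W F) →
      Sat F V w (toFm φ) ⇔ Sat F V w (toFm (T φ))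

-- strong: L ⪯ L'.  New letters are Fin k (alphabet P' = ℕ ⊎ Fin k);
-- an extension of (F , V) is (F , [V , U]) for U : W → Fin k → Set.
_⪯[_]_ : Logic → Set → Logic → Set₁
L ⪯[ τ ] L' =
  Σ (Form τ ℕ L → Σ ℕ λ k → Form τ (ℕ ⊎ Fin k) L') λ T →
    (φ : Form τ ℕ L) (F : Frame τ) (V : W F → ℕ → Set) (w : W F) →
      let k  = Σ.proj₁ (T φ)
          φ' = Σ.proj₂ (T φ)
      in Sat F V w (toFm φ)
         ⇔ Σ (W F → Fin k → Set) λ U →
              Sat F (λ v → [ V v , U v ]) w (toFm φ')

Incomparable : Set → Logic → Logic → Set₁
Incomparable τ L L' = ¬ (L ⪯[ τ ] L') × ¬ (L' ⪯[ τ ] L)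

Incomparableʷ : Set → Logic → Logic → Set₁
Incomparableʷ τ L L' = ¬ (L ⪯ʷ[ τ ] L') × ¬ (L' ⪯ʷ[ τ ] L)

-- Horn formulas with box-only literals are preserved under intersections of valuations
-- on a fixed frame, and Horn formulas with diamond-only literals under products of
-- models: the literals commute with the meet, and a Horn clause true in both factors
-- has a negative literal false in one factor, hence at the meet, or else its single
-- positive literal true in both.  Extensions of the factors combine to an extension of
-- the meet, so fresh letters do not help, while ◇p is not preserved by intersections
-- and ¬□□p ∨ □p is not preserved by products.  For the weak separations, deleting the
-- edge from w to one of two dead-end successors changes ◇p (resp. ¬□p) but no box-only
-- (resp. diamond-only) literal, provided the deleted successor carries at least
-- (resp. at most) the letters of the kept one.
module Submission where

open import Defs
open import Data.Nat using (ℕ; suc; _≤_; s≤s)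
open import Data.Nat.Properties using (≤-refl)
open import Data.Fin using (Fin; zero)
open import Data.Product using (_×_; _,_; proj₁; proj₂)
open import Data.Sum using (_⊎_; inj₁; inj₂; [_,_])
open import Data.Unit using (tt)
open import Data.Empty using (⊥-elim) renaming (⊥ to Empty)
open import Data.List using (List; []; _∷_; length; map; foldr)
open import Data.List.Relation.Unary.All using (All; []; _∷_)
open import Data.List.Relation.Unary.Any using (Any; here; there)
import Data.List.Relation.Unary.Any.Properties as Any
open import Function using (id; _∘_; case_of_)
open import Function.Bundles using (_⇔_; mk⇔; Equivalence)
open import Relation.Binary.PropositionalEquality using (_≡_; refl)
open import Relation.Nullary using (¬_)

open Equivalence using (to; from)

private
  variable
    τ A B : Set

Any-mapWithAll : {P Q R : A → Set} {xs : List A} →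
  (∀ {x} → P x → Q x → R x) → All P xs → Any Q xs → Any R xs
Any-mapWithAll f (p ∷ _)  (here q)  = here (f p q)
Any-mapWithAll f (_ ∷ ps) (there q) = there (Any-mapWithAll f ps q)

¬∨¬-map : {A₁ B₁ A₂ B₂ : Set} → (A₁ → A₂) → (B₁ → B₂) → ¬ (¬ A₁ ⊎ ¬ B₁) → ¬ (¬ A₂ ⊎ ¬ B₂)
¬∨¬-map f g h (inj₁ ¬a) = h (inj₁ (¬a ∘ f))
¬∨¬-map f g h (inj₂ ¬b) = h (inj₂ (¬b ∘ g))

¬∨¬-zipWith : {A₁ B₁ A₂ B₂ A₃ B₃ : Set} → (A₁ → A₂ → A₃) → (B₁ → B₂ → B₃) →
  ¬ (¬ A₁ ⊎ ¬ B₁) → ¬ (¬ A₂ ⊎ ¬ B₂) → ¬ (¬ A₃ ⊎ ¬ B₃)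
¬∨¬-zipWith f g h₁ h₂ (inj₁ ¬a) = h₁ (inj₁ λ a₁ → h₂ (inj₁ λ a₂ → ¬a (f a₁ a₂)))
¬∨¬-zipWith f g h₁ h₂ (inj₂ ¬b) = h₁ (inj₂ λ b₁ → h₂ (inj₂ λ b₂ → ¬b (g b₁ b₂)))

clauseBody : List (Lit τ A) → List (Lit τ A) → List (Fm τ A)
clauseBody negs poss = foldr (λ l r → (¬ᶠ litFm l) ∷ r) (map litFm poss) negs

module _ (F : Frame τ) (V : W F → A → Set) (x : W F) where

  SatLit : Lit τ A → Set
  SatLit l = Sat F V x (litFm l)

  SatClause : List (Lit τ A) → List (Lit τ A) → Set
  SatClause negs poss = Any (¬_ ∘ SatLit) negs ⊎ Any SatLit poss

  Sat-disj⁺ : (φs : List (Fm τ A)) → Any (Sat F V x) φs → Sat F V x (disj φs)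
  Sat-disj⁺ (_ ∷ [])         (here s)  = s
  Sat-disj⁺ (_ ∷ _ ∷ _)      (here s)  = inj₁ s
  Sat-disj⁺ (_ ∷ φs@(_ ∷ _)) (there s) = inj₂ (Sat-disj⁺ φs s)

  Sat-disj⁻ : (φs : List (Fm τ A)) → Sat F V x (disj φs) → Any (Sat F V x) φs
  Sat-disj⁻ []               s        = ⊥-elim (s tt)
  Sat-disj⁻ (_ ∷ [])         s        = here s
  Sat-disj⁻ (_ ∷ _ ∷ _)      (inj₁ s) = here s
  Sat-disj⁻ (_ ∷ φs@(_ ∷ _)) (inj₂ s) = there (Sat-disj⁻ φs s)

  Sat-clauseBody⁺ : ∀ negs poss → SatClause negs poss → Sat F V x (disj (clauseBody negs poss))
  Sat-clauseBody⁺ negs poss = Sat-disj⁺ (clauseBody negs poss) ∘ go negs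
    where
    go : ∀ negs → SatClause negs poss → Any (Sat F V x) (clauseBody negs poss)
    go []       (inj₂ s)         = Any.map⁺ s
    go (_ ∷ _)  (inj₁ (here s))  = here s
    go (_ ∷ ls) (inj₁ (there s)) = there (go ls (inj₁ s))
    go (_ ∷ ls) (inj₂ s)         = there (go ls (inj₂ s))

  Sat-clauseBody⁻ : ∀ negs poss → Sat F V x (disj (clauseBody negs poss)) → SatClause negs poss
  Sat-clauseBody⁻ negs poss = go negs ∘ Sat-disj⁻ (clauseBody negs poss)
    where
    go : ∀ negs → Any (Sat F V x) (clauseBody negs poss) → SatClause negs poss
    go []       s         = inj₂ (Any.map⁻ s)
    go (_ ∷ _)  (here s)  = inj₁ (here s)
    go (_ ∷ ls) (there s) = [ inj₁ ∘ there , inj₂ ] (go ls s)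

HornShape : Shape → Set
HornShape s = ∀ {n m} → ShapeOK s n m → m ≤ 1

DeadEnd : (F : Frame τ) → W F → Set
DeadEnd F x = ∀ a y → ¬ R F a x y

SatLit-deadEnd : {F G : Frame τ} {V : W F → A → Set} {U : W G → A → Set} {x : W F} {y : W G} →
  DeadEnd F x → DeadEnd G y → (∀ p → V x p → U y p) → ∀ l → SatLit F V x l → SatLit G U y l
SatLit-deadEnd _     _     _   ⊤ˡ       _           = tt
SatLit-deadEnd _     _     V⊆U (varˡ p) s           = V⊆U p s
SatLit-deadEnd deadF _     _   (◇ˡ a l) (y , r , _) = ⊥-elim (deadF a y r)
SatLit-deadEnd _     deadG _   (□ˡ a l) _ y r       = ⊥-elim (deadG a y r)

¬⪯ʷ-if-preserved : {L L' : Logic} {F G : Frame τ} {V : W F → ℕ → Set} {U : W G → ℕ → Set}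
  {x : W F} {y : W G} (φ : Form τ ℕ L) →
  Sat F V x (toFm φ) → ¬ Sat G U y (toFm φ) →
  ((ψ : Form τ ℕ L') → Sat F V x (toFm ψ) → Sat G U y (toFm ψ)) →
  ¬ (L ⪯ʷ[ τ ] L')
¬⪯ʷ-if-preserved {F = F} {G} {V} {U} {x} {y} φ sat ¬sat preserved (T , T-correct) =
  ¬sat (from (T-correct φ G U y) (preserved (T φ) (to (T-correct φ F V x) sat)))

module Transfer {F G : Frame τ} {V : W F → A → Set} {U : W G → A → Set} (P : Pol)
  (π : W G → W F) (π-hom : ∀ {a x y} → R G a x y → R F a (π x) (π y))
  (SatLit⇔ : ∀ x l → LitOK P l → SatLit G U x l ⇔ SatLit F V (π x) l)
  where

  transfer-boxes : ∀ ∇ {φ} → (∀ y → Sat F V (π y) φ → Sat G U y φ) →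
    ∀ x → Sat F V (π x) (boxes ∇ φ) → Sat G U x (boxes ∇ φ)
  transfer-boxes []      h = h
  transfer-boxes (a ∷ ∇) h x s y r = transfer-boxes ∇ h y (s (π y) (π-hom r))

  transfer-clauseBody : ∀ {negs poss} → All (LitOK P) negs → All (LitOK P) poss →
    ∀ x → SatClause F V (π x) negs poss → SatClause G U x negs poss
  transfer-clauseBody oks⁻ oks⁺ x =
    [ inj₁ ∘ Any-mapWithAll (λ {l} ok ¬l → ¬l ∘ to (SatLit⇔ x l ok)) oks⁻
    , inj₂ ∘ Any-mapWithAll (λ {l} ok → from (SatLit⇔ x l ok)) oks⁺ ]

  transfer : ∀ {s} φ → InFrag s P φ → ∀ x → Sat F V (π x) (cfFm φ) → Sat G U x (cfFm φ)
  transfer (lit l)              ok                 x    = from (SatLit⇔ x l ok)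
  transfer (neglit l)           ok                 x ¬l = ¬l ∘ to (SatLit⇔ x l ok)
  transfer (clause ∇ negs poss) (oks⁻ , oks⁺ , _) =
    transfer-boxes ∇ λ y → Sat-clauseBody⁺ G U y negs poss
                         ∘ transfer-clauseBody oks⁻ oks⁺ y
                         ∘ Sat-clauseBody⁻ F V (π y) negs poss
  transfer (φ ∧ᶜ ψ)             (ok₁ , ok₂)        x = ¬∨¬-map (transfer φ ok₁ x) (transfer ψ ok₂ x)

module Meet {F₁ F₂ F₃ : Frame τ} (π₁ : W F₃ → W F₁) (π₂ : W F₃ → W F₂) where

  _⊓_ : (W F₁ → B → Set) → (W F₂ → B → Set) → W F₃ → B → Set
  (V₁ ⊓ V₂) x b = V₁ (π₁ x) b × V₂ (π₂ x) b

  record IsMeet (V₃ : W F₃ → B → Set) (V₁ : W F₁ → B → Set) (V₂ : W F₂ → B → Set) : Set where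
    constructor isMeet
    field pointwise : ∀ x b → V₃ x b ⇔ (V₁ ⊓ V₂) x b
  open IsMeet public

  ⊓-isMeet : (V₁ : W F₁ → B → Set) (V₂ : W F₂ → B → Set) → IsMeet (V₁ ⊓ V₂) V₁ V₂
  ⊓-isMeet V₁ V₂ = isMeet λ _ _ → mk⇔ id id

  [,]-isMeet : {V₁ : W F₁ → A → Set} {V₂ : W F₂ → A → Set} {V₃ : W F₃ → A → Set}
    {U₁ : W F₁ → B → Set} {U₂ : W F₂ → B → Set} {U₃ : W F₃ → B → Set} →
    IsMeet V₃ V₁ V₂ → IsMeet U₃ U₁ U₂ →
    IsMeet (λ x → [ V₃ x , U₃ x ]) (λ x → [ V₁ x , U₁ x ]) (λ x → [ V₂ x , U₂ x ])
  [,]-isMeet (isMeet V-meet) (isMeet U-meet) = isMeet λ where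
    x (inj₁ a) → V-meet x a
    x (inj₂ b) → U-meet x b

  MeetPreserves : Logic → Set₁
  MeetPreserves L = ∀ {B} {V₁ : W F₁ → B → Set} {V₂ : W F₂ → B → Set} {V₃ : W F₃ → B → Set} →
    IsMeet V₃ V₁ V₂ → (ψ : Form τ B L) (x : W F₃) →
    Sat F₁ V₁ (π₁ x) (toFm ψ) → Sat F₂ V₂ (π₂ x) (toFm ψ) → Sat F₃ V₃ x (toFm ψ)

  LiteralsMeetPreserved : Pol → Set₁
  LiteralsMeetPreserved P = ∀ {B} {V₁ : W F₁ → B → Set} {V₂ : W F₂ → B → Set} {V₃ : W F₃ → B → Set} →
    IsMeet V₃ V₁ V₂ → ∀ x (l : Lit τ B) → LitOK P l →
    SatLit F₃ V₃ x l ⇔ (SatLit F₁ V₁ (π₁ x) l × SatLit F₂ V₂ (π₂ x) l)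

  -- The translation of φ would hold at the meet of the witnessing extensions.
  ¬⪯-if-meetPreserves : {L L' : Logic} → MeetPreserves L' →
    (φ : Form τ ℕ L) (V₁ : W F₁ → ℕ → Set) (V₂ : W F₂ → ℕ → Set) (x : W F₃) →
    Sat F₁ V₁ (π₁ x) (toFm φ) → Sat F₂ V₂ (π₂ x) (toFm φ) → ¬ Sat F₃ (V₁ ⊓ V₂) x (toFm φ) →
    ¬ (L ⪯[ τ ] L')
  ¬⪯-if-meetPreserves preserves φ V₁ V₂ x sat₁ sat₂ ¬sat₃ (T , T-correct)
    with to (T-correct φ F₁ V₁ (π₁ x)) sat₁ | to (T-correct φ F₂ V₂ (π₂ x)) sat₂
  ... | U₁ , sat₁' | U₂ , sat₂' =
    ¬sat₃ (from (T-correct φ F₃ (V₁ ⊓ V₂) x)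
      (U₁ ⊓ U₂ , preserves ([,]-isMeet (⊓-isMeet V₁ V₂) (⊓-isMeet U₁ U₂)) (proj₂ (T φ)) x sat₁' sat₂'))

  module _ (π₁-hom : ∀ {a x y} → R F₃ a x y → R F₁ a (π₁ x) (π₁ y))
           (π₂-hom : ∀ {a x y} → R F₃ a x y → R F₂ a (π₂ x) (π₂ y))
           {P : Pol} (literals : LiteralsMeetPreserved P)
    where

    module _ {V₁ : W F₁ → B → Set} {V₂ : W F₂ → B → Set} {V₃ : W F₃ → B → Set}
             (meet : IsMeet V₃ V₁ V₂)
      where

      meet-boxes : ∀ ∇ {φ} → (∀ y → Sat F₁ V₁ (π₁ y) φ → Sat F₂ V₂ (π₂ y) φ → Sat F₃ V₃ y φ) →
        ∀ x → Sat F₁ V₁ (π₁ x) (boxes ∇ φ) → Sat F₂ V₂ (π₂ x) (boxes ∇ φ) → Sat F₃ V₃ x (boxes ∇ φ)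
      meet-boxes []      h = h
      meet-boxes (a ∷ ∇) h x s₁ s₂ y r =
        meet-boxes ∇ h y (s₁ (π₁ y) (π₁-hom r)) (s₂ (π₂ y) (π₂-hom r))

      meet-hornClauseBody : ∀ {negs poss} → All (LitOK P) negs → All (LitOK P) poss →
        length poss ≤ 1 → ∀ x →
        SatClause F₁ V₁ (π₁ x) negs poss → SatClause F₂ V₂ (π₂ x) negs poss →
        SatClause F₃ V₃ x negs poss
      meet-hornClauseBody oks⁻ _ _ x (inj₁ ¬s₁) _ =
        inj₁ (Any-mapWithAll (λ {l} ok ¬l₁ → ¬l₁ ∘ proj₁ ∘ to (literals meet x l ok)) oks⁻ ¬s₁)
      meet-hornClauseBody oks⁻ _ _ x (inj₂ _) (inj₁ ¬s₂) =
        inj₁ (Any-mapWithAll (λ {l} ok ¬l₂ → ¬l₂ ∘ proj₂ ∘ to (literals meet x l ok)) oks⁻ ¬s₂)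
      meet-hornClauseBody {poss = l ∷ []} _ (ok ∷ []) _ x (inj₂ (here s₁)) (inj₂ (here s₂)) =
        inj₂ (here (from (literals meet x l ok) (s₁ , s₂)))
      meet-hornClauseBody _ (_ ∷ _ ∷ _) (s≤s ()) _ _ _

      meet-horn : ∀ {s} → HornShape s → ∀ φ → InFrag s P φ → ∀ x →
        Sat F₁ V₁ (π₁ x) (cfFm φ) → Sat F₂ V₂ (π₂ x) (cfFm φ) → Sat F₃ V₃ x (cfFm φ)
      meet-horn _ (lit l) ok x s₁ s₂ = from (literals meet x l ok) (s₁ , s₂)
      meet-horn _ (neglit l) ok x ¬s₁ _ = ¬s₁ ∘ proj₁ ∘ to (literals meet x l ok)
      meet-horn horn (clause ∇ negs poss) (oks⁻ , oks⁺ , shape) =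
        meet-boxes ∇ λ y s₁ s₂ →
          Sat-clauseBody⁺ F₃ V₃ y negs poss
            (meet-hornClauseBody oks⁻ oks⁺ (horn shape) y
              (Sat-clauseBody⁻ F₁ V₁ (π₁ y) negs poss s₁)
              (Sat-clauseBody⁻ F₂ V₂ (π₂ y) negs poss s₂))
      meet-horn horn (φ ∧ᶜ ψ) (ok₁ , ok₂) x =
        ¬∨¬-zipWith (meet-horn horn φ ok₁ x) (meet-horn horn ψ ok₂ x)

    horn-meetPreserves : ∀ {s} → HornShape s → MeetPreserves (logic s P)
    horn-meetPreserves horn meet (φ , ok) = meet-horn meet horn φ ok

module Intersection (F : Frame τ) where
  open Meet {F₁ = F} {F} {F} id id public

  □-literalsMeetPreserved : LiteralsMeetPreserved BoxOnly
  □-literalsMeetPreserved meet x ⊤ˡ       _  = mk⇔ (λ _ → tt , tt) (λ _ → tt)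
  □-literalsMeetPreserved meet x (varˡ p) _  = pointwise meet x p
  □-literalsMeetPreserved {V₁ = V₁} {V₂} {V₃} meet x (□ˡ a l) ok = mk⇔
    (λ s → (λ y r → proj₁ (to (meetAt y) (s y r))) , (λ y r → proj₂ (to (meetAt y) (s y r))))
    (λ (s₁ , s₂) y r → from (meetAt y) (s₁ y r , s₂ y r))
    where
    meetAt : ∀ y → SatLit F V₃ y l ⇔ (SatLit F V₁ y l × SatLit F V₂ y l)
    meetAt y = □-literalsMeetPreserved meet y l ok

  intersection-preserves-□Horn : ∀ {s} → HornShape s → MeetPreserves (logic s BoxOnly)
  intersection-preserves-□Horn = horn-meetPreserves id id □-literalsMeetPreserved

_⊗_ : Frame τ → Frame τ → Frame τ
F₁ ⊗ F₂ = record
  { W = W F₁ × W F₂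
  ; R = λ a x y → R F₁ a (proj₁ x) (proj₁ y) × R F₂ a (proj₂ x) (proj₂ y)
  }

module Product (F₁ F₂ : Frame τ) where
  open Meet {F₁ = F₁} {F₂} {F₁ ⊗ F₂} proj₁ proj₂ public

  ◇-literalsMeetPreserved : LiteralsMeetPreserved DiaOnly
  ◇-literalsMeetPreserved meet x ⊤ˡ       _  = mk⇔ (λ _ → tt , tt) (λ _ → tt)
  ◇-literalsMeetPreserved meet x (varˡ p) _  = pointwise meet x p
  ◇-literalsMeetPreserved {V₁ = V₁} {V₂} {V₃} meet x (◇ˡ a l) ok = mk⇔
    (λ (y , (r₁ , r₂) , s) →
      (proj₁ y , r₁ , proj₁ (to (meetAt y) s)) , (proj₂ y , r₂ , proj₂ (to (meetAt y) s)))
    (λ ((y₁ , r₁ , s₁) , (y₂ , r₂ , s₂)) → (y₁ , y₂) , (r₁ , r₂) , from (meetAt (y₁ , y₂)) (s₁ , s₂))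
    where
    meetAt : ∀ y → SatLit (F₁ ⊗ F₂) V₃ y l ⇔ (SatLit F₁ V₁ (proj₁ y) l × SatLit F₂ V₂ (proj₂ y) l)
    meetAt y = ◇-literalsMeetPreserved meet y l ok

  product-preserves-◇Horn : ∀ {s} → HornShape s → MeetPreserves (logic s DiaOnly)
  product-preserves-◇Horn = horn-meetPreserves proj₁ proj₂ ◇-literalsMeetPreserved

data Pt : Set where
  w v₁ v₂ : Pt

data Fork : Pt → Pt → Set where
  w→v₁ : Fork w v₁
  w→v₂ : Fork w v₂

data Edge : Pt → Pt → Set where
  w→v₂ : Edge w v₂

data Chain : Pt → Pt → Set where
  w→v₁  : Chain w v₁
  v₁→v₂ : Chain v₁ v₂

edge⊆fork : ∀ {x y} → Edge x y → Fork x y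
edge⊆fork w→v₂ = w→v₂

onlyAt : Pt → Pt → ℕ → Set
onlyAt x y _ = x ≡ y

nowhere : Pt → ℕ → Set
nowhere _ _ = Empty

module Separations {τ : Set} (a : τ) where

  frameOn : (Pt → Pt → Set) → Frame τ
  frameOn S = record { W = Pt ; R = λ _ → S }

  fork edge chain : Frame τ
  fork  = frameOn Fork
  edge  = frameOn Edge
  chain = frameOn Chain

  p : Lit τ ℕ
  p = varˡ 0

  module _ {V : Pt → ℕ → Set} where

    leaf⇔ : ∀ {x} → DeadEnd fork x → ∀ l → SatLit edge V x l ⇔ SatLit fork V x l
    leaf⇔ {x} dead l = mk⇔ (SatLit-deadEnd dead-in-edge dead (λ _ → id) l)
                           (SatLit-deadEnd dead dead-in-edge (λ _ → id) l)
      where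
      dead-in-edge : DeadEnd edge x
      dead-in-edge a y r = dead a y (edge⊆fork r)

    fork-edge-□ : (∀ q → V v₂ q → V v₁ q) → ∀ x l → LitOK BoxOnly l → SatLit edge V x l ⇔ SatLit fork V x l
    fork-edge-□ _   v₁ l        _ = leaf⇔ (λ _ _ ()) l
    fork-edge-□ _   v₂ l        _ = leaf⇔ (λ _ _ ()) l
    fork-edge-□ _   w  ⊤ˡ       _ = mk⇔ id id
    fork-edge-□ _   w  (varˡ q) _ = mk⇔ id id
    fork-edge-□ V⊆ w  (□ˡ _ l)  _ = mk⇔
      (λ s → λ { v₁ w→v₁ → SatLit-deadEnd (λ _ _ ()) (λ _ _ ()) V⊆ l (s v₂ w→v₂)
               ; v₂ w→v₂ → to (leaf⇔ (λ _ _ ()) l) (s v₂ w→v₂) })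
      (λ s → λ { v₂ w→v₂ → from (leaf⇔ (λ _ _ ()) l) (s v₂ w→v₂) })

    fork-edge-◇ : (∀ q → V v₁ q → V v₂ q) → ∀ x l → LitOK DiaOnly l → SatLit edge V x l ⇔ SatLit fork V x l
    fork-edge-◇ _   v₁ l        _ = leaf⇔ (λ _ _ ()) l
    fork-edge-◇ _   v₂ l        _ = leaf⇔ (λ _ _ ()) l
    fork-edge-◇ _   w  ⊤ˡ       _ = mk⇔ id id
    fork-edge-◇ _   w  (varˡ q) _ = mk⇔ id id
    fork-edge-◇ V⊆ w  (◇ˡ _ l)  _ = mk⇔
      (λ { (v₂ , w→v₂ , s) → v₂ , w→v₂ , to (leaf⇔ (λ _ _ ()) l) s })
      (λ { (v₁ , w→v₁ , s) → v₂ , w→v₂ , SatLit-deadEnd (λ _ _ ()) (λ _ _ ()) V⊆ l s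
         ; (v₂ , w→v₂ , s) → v₂ , w→v₂ , from (leaf⇔ (λ _ _ ()) l) s })

  ◇-not-⪯ʷ-□ : ∀ s s' → ¬ (logic s DiaOnly ⪯ʷ[ τ ] logic s' BoxOnly)
  ◇-not-⪯ʷ-□ s s' =
    ¬⪯ʷ-if-preserved {V = onlyAt v₁} {x = w} {y = w} (lit (◇ˡ a p) , tt)
      (v₁ , w→v₁ , refl) (λ { (v₂ , w→v₂ , ()) }) (λ (ψ , ok) → transfer ψ ok w)
    where open Transfer BoxOnly id edge⊆fork (fork-edge-□ {V = onlyAt v₁} λ _ ())

  □-not-⪯ʷ-◇ : ∀ s s' → ¬ (logic s BoxOnly ⪯ʷ[ τ ] logic s' DiaOnly)
  □-not-⪯ʷ-◇ s s' =
    ¬⪯ʷ-if-preserved {V = onlyAt v₂} {x = w} {y = w} (neglit (□ˡ a p) , tt)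
      (λ □p → case □p v₁ w→v₁ of λ ()) (λ ¬□p → ¬□p λ { v₂ w→v₂ → refl })
      (λ (ψ , ok) → transfer ψ ok w)
    where open Transfer DiaOnly id edge⊆fork (fork-edge-◇ {V = onlyAt v₂} λ _ ())

  ◇-not-⪯-□ : ∀ s {s'} → HornShape s' → ¬ (logic s DiaOnly ⪯[ τ ] logic s' BoxOnly)
  ◇-not-⪯-□ s horn =
    ¬⪯-if-meetPreserves (intersection-preserves-□Horn horn) (lit (◇ˡ a p) , tt)
      (onlyAt v₁) (onlyAt v₂) w (v₁ , w→v₁ , refl) (v₂ , w→v₂ , refl)
      λ { (v₁ , _ , _ , ()) ; (v₂ , _ , () , _) }
    where open Intersection fork

  -- The only successor of (w , w) in chain ⊗ edge is the dead end (v₁ , v₂), where p fails.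
  □-not-⪯-◇ : ∀ {s s'} → ShapeOK s 1 1 → HornShape s' → ¬ (logic s BoxOnly ⪯[ τ ] logic s' DiaOnly)
  □-not-⪯-◇ shape horn =
    ¬⪯-if-meetPreserves (product-preserves-◇Horn horn) ¬□□p∨□p nowhere (onlyAt v₂) (w , w)
      (inj₁ λ □□p → □□p v₁ w→v₁ v₂ v₁→v₂)
      (inj₂ λ { v₂ w→v₂ → refl })
      λ { (inj₁ ¬□□p) → ¬□□p λ { (_ , v₂) (_ , w→v₂) _ (_ , ()) }
        ; (inj₂ □p)   → proj₁ (□p (v₁ , v₂) (w→v₁ , w→v₂)) }
    where
    open Product chain edge
    ¬□□p∨□p : Form τ ℕ (logic _ BoxOnly)
    ¬□□p∨□p = clause [] (□ˡ a (□ˡ a p) ∷ []) (□ˡ a p ∷ []) , (tt ∷ [] , tt ∷ [] , shape)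

corollary2 : (n : ℕ) →
    Incomparable (Fin (suc n)) (logic Horn BoxOnly) (logic Horn DiaOnly)
    × Incomparableʷ (Fin (suc n)) (logic Krom BoxOnly) (logic Krom DiaOnly)
    × Incomparable (Fin (suc n)) (logic Core BoxOnly) (logic Core DiaOnly)
corollary2 n =
    (□-not-⪯-◇ ≤-refl id , ◇-not-⪯-□ Horn id)
  , (□-not-⪯ʷ-◇ Krom Krom , ◇-not-⪯ʷ-□ Krom Krom)
  , (□-not-⪯-◇ (≤-refl , ≤-refl) proj₁ , ◇-not-⪯-□ Core proj₁)
  where open Separations {Fin (suc n)} zero
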